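{- Let $U$ be a finite set with $n=|U|$ and $\mathcal S\subseteq 2^U$ a family covering $U$, and construct $M_1,M_2,\mathbb B^{\mathrm s},\mathbb B^{\mathrm t}$ and $L=2n^2$ as described in the context. If $\mathcal S^*\subseteq\mathcal S$ is a set cover of $U$ of size at most $k$, then there is a reconfiguration sequence between $\mathbb B^{\mathrm s}$ and $\mathbb B^{\mathrm t}$ (for $\mathbb M=(M_1,M_2)$) of length at most $2kL+7n$.
   Context: Fix an arbitrary total order $\preceq$ on $\mathcal S$. For $u\in U$ let $f(u)=|\{S\in\mathcal S: u\in S\}|$, and for $u\in S\in\mathcal S$ let $\mathrm{id}(u,S)=|\{S'\in\mathcal S: S'\preceq S,\ u\in S'\}|$. Let $L=2n^2$. Elements: for each $u\in U$, $e_u^1,e_u^2,e_u^3,c_u^1,\dots,c_u^{f(u)}$; for each $S\in\mathcal S$, $s_S^1,\dots,s_S^{L+1}$ (all distinct). Blocks (uniform matroids): $M_u^1$ rank 1 on $\{e_u^1,e_u^2\}$; $M_u^2$ rank 1 on $\{e_u^1,e_u^2,e_u^3\}$; $M_u^3$ rank 1 on $\{e_u^3,c_u^1,\dots,c_u^{f(u)}\}$; $M_S^0$ of rank $|S|$ on $\{c_u^{\mathrm{id}(u,S)}: u\in S\}\cup\{s_S^1\}$; $M_S^i$ rank 1 on $\{s_S^i,s_S^{i+1}\}$ for $1\le i\le L$. Let $M_1=\bigoplus_u M_u^1\oplus\bigoplus_u M_u^3\oplus\bigoplus_S\bigoplus_{i=1}^{n^2}M_S^{2i-1}$ and $M_2=\bigoplus_u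 M_u^2\oplus\bigoplus_S M_S^0\oplus\bigoplus_S\bigoplus_{i=1}^{n^2}M_S^{2i}$ (direct sums; $M_1,M_2$ are partition matroids, their ground sets overlap). Let $\mathbb B^{\mathrm s}=(B^{\mathrm s}_1,B^{\mathrm s}_2)$ with $B^{\mathrm s}_1=\{e_u^1:u\in U\}\cup\{e_u^3:u\in U\}\cup\bigcup_S\{s_S^{2i-1}:i\in[n^2]\}$, $B^{\mathrm s}_2=\{e_u^2:u\in U\}\cup\bigcup_S\{c_u^{\mathrm{id}(u,S)}:u\in S\}\cup\bigcup_S\{s_S^{2i}:i\in[n^2]\}$, and $\mathbb B^{\mathrm t}=(B^{\mathrm t}_1,B^{\mathrm t}_2)$ obtained by swapping the roles of $e_u^1$ and $e_u^2$: $B^{\mathrm t}_1=\{e_u^2\}\cup\{e_u^3\}\cup\bigcup_S\{s_S^{2i-1}\}$, $B^{\mathrm t}_2=\{e_u^1\}\cup\bigcup_S\{c_u^{\mathrm{id}(u,S)}:u\in S\}\cup\bigcup_S\{s_S^{2i}\}$. For matroids $M_1,M_2$, a feasible basis sequence is a pair of disjoint bases $(B_1,B_2)$; two are adjacent if they differ in one coordinate $i$ with $B'_i=B_i-x+y$, $x\in B_i$, $y\in E_i\setminus B_i$; a reconfiguration sequence of length $\ell$ is a sequence of $\ell+1$ feasible basis sequences with consecutive ones adjacent. -}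

module Defs where

open import Data.Nat using (ℕ; zero; suc; _+_; _*_; _∸_; _≤_; _≤ᵇ_; _≡ᵇ_)
open import Data.Bool using (Bool; true; false; _∧_)
open import Data.Fin using (Fin; toℕ)
open import Data.Fin.Subset using (Subset)
open import Data.Vec using (lookup)
open import Data.List using (List; []; _∷_; _++_; map; length; filterᵇ; upTo; allFin; concatMap)
open import Data.Bool.ListAction using (any)
open import Data.List.Membership.Propositional using (_∈_)
open import Data.Product using (Σ; _×_; _,_; ∃)
open import Data.Sum using (_⊎_)
open import Relation.Binary.PropositionalEquality using (_≡_)
open import Relation.Nullary using (¬_)
open import Function.Bundles using (_⇔_)

-- A partition matroid (direct sum of uniform matroids) is given by a
-- list of blocks; each block is a list of (distinct) elements together
-- with its rank.
Block : Set → Set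
Block E = List E × ℕ

SetOf : Set → Set
SetOf E = E → Bool

count : {E : Set} → SetOf E → List E → ℕ
count B xs = length (filterᵇ B xs)

InGround : {E : Set} → List (Block E) → E → Set
InGround bs z = Σ (Block _) λ b → (b ∈ bs) × (z ∈ Data.Product.proj₁ b)

IsBasis : {E : Set} → List (Block E) → SetOf E → Set
IsBasis bs B =
  (∀ z → B z ≡ true → InGround bs z) ×
  (∀ b → b ∈ bs → count B (Data.Product.proj₁ b) ≡ Data.Product.proj₂ b)

Exchange : {E : Set} → List (Block E) → SetOf E → SetOf E → Set
Exchange {E} bs B B' = Σ E λ x → Σ E λ y →
  (B x ≡ true) × InGround bs y × (B y ≡ false) ×
  (∀ z → (B' z ≡ true) ⇔ ((z ≡ y) ⊎ ((B z ≡ true) × ¬ (z ≡ x))))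

SameSet : {E : Set} → SetOf E → SetOf E → Set
SameSet B B' = ∀ z → B z ≡ B' z

module Reconfiguration {E : Set} (M₁ M₂ : List (Block E)) where

  Config : Set
  Config = SetOf E × SetOf E

  Feasible : Config → Set
  Feasible (B₁ , B₂) =
    IsBasis M₁ B₁ × IsBasis M₂ B₂ × (∀ z → B₁ z ≡ true → B₂ z ≡ false)

  Adjacent : Config → Config → Set
  Adjacent (B₁ , B₂) (B₁' , B₂') =
    (Exchange M₁ B₁ B₁' × SameSet B₂ B₂') ⊎
    (SameSet B₁ B₁' × Exchange M₂ B₂ B₂')

  SameConfig : Config → Config → Set
  SameConfig (B₁ , B₂) (B₁' , B₂') = SameSet B₁ B₁' × SameSet B₂ B₂'

  data Reconf : ℕ → Config → Config → Set where
    done : ∀ {P Q} → Feasible P → SameConfig P Q → Reconf 0 P Q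
    step : ∀ {ℓ P P' Q} → Feasible P → Adjacent P P' → Reconf ℓ P' Q →
           Reconf (suc ℓ) P Q

-- The construction.  U = Fin n, 𝒮 = {𝒮 j | j : Fin m}, ordered by index.

module Construction (n m : ℕ) (𝒮 : Fin m → Subset n) where

  L : ℕ
  L = 2 * (n * n)

  oneTo : ℕ → List ℕ
  oneTo N = map suc (upTo N)

  memb : Fin m → Fin n → Bool
  memb j u = lookup (𝒮 j) u

  members : Fin m → List (Fin n)
  members j = filterᵇ (memb j) (allFin n)

  size : Fin m → ℕ
  size j = length (members j)

  f : Fin n → ℕ
  f u = length (filterᵇ (λ j → memb j u) (allFin m))

  idx : Fin n → Fin m → ℕ
  idx u j = length (filterᵇ (λ j' → (toℕ j' ≤ᵇ toℕ j) ∧ memb j' u) (allFin m))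

  data Elem : Set where
    e¹ e² e³ : Fin n → Elem
    c : Fin n → ℕ → Elem
    s : Fin m → ℕ → Elem

  Mu1 Mu2 Mu3 : Fin n → Block Elem
  Mu1 u = (e¹ u ∷ e² u ∷ []) , 1
  Mu2 u = (e¹ u ∷ e² u ∷ e³ u ∷ []) , 1
  Mu3 u = (e³ u ∷ map (c u) (oneTo (f u))) , 1

  MS0 : Fin m → Block Elem
  MS0 j = (map (λ u → c u (idx u j)) (members j) ++ (s j 1 ∷ [])) , size j

  MSi : Fin m → ℕ → Block Elem
  MSi j i = (s j i ∷ s j (suc i) ∷ []) , 1

  M₁ : List (Block Elem)
  M₁ = map Mu1 (allFin n) ++ map Mu3 (allFin n) ++
       concatMap (λ j → map (λ i → MSi j (2 * i ∸ 1)) (oneTo (n * n))) (allFin m)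

  M₂ : List (Block Elem)
  M₂ = map Mu2 (allFin n) ++ map MS0 (allFin m) ++
       concatMap (λ j → map (λ i → MSi j (2 * i)) (oneTo (n * n))) (allFin m)

  oddS evenS : ℕ → Bool
  oddS k = any (λ i → (2 * i ∸ 1) ≡ᵇ k) (oneTo (n * n))
  evenS k = any (λ i → (2 * i) ≡ᵇ k) (oneTo (n * n))

  cMem : Fin n → ℕ → Bool
  cMem u k = any (λ j → memb j u ∧ (idx u j ≡ᵇ k)) (allFin m)

  Bs₁ Bs₂ Bt₁ Bt₂ : SetOf Elem
  Bs₁ (e¹ u) = true
  Bs₁ (e² u) = false
  Bs₁ (e³ u) = true
  Bs₁ (c u k) = false
  Bs₁ (s j k) = oddS k

  Bs₂ (e¹ u) = false
  Bs₂ (e² u) = true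
  Bs₂ (e³ u) = false
  Bs₂ (c u k) = cMem u k
  Bs₂ (s j k) = evenS k

  Bt₁ (e¹ u) = false
  Bt₁ (e² u) = true
  Bt₁ (e³ u) = true
  Bt₁ (c u k) = false
  Bt₁ (s j k) = oddS k

  Bt₂ (e¹ u) = true
  Bt₂ (e² u) = false
  Bt₂ (e³ u) = false
  Bt₂ (c u k) = cMem u k
  Bt₂ (s j k) = evenS k

  𝔹s 𝔹t : SetOf Elem × SetOf Elem
  𝔹s = Bs₁ , Bs₂
  𝔹t = Bt₁ , Bt₂

  open Reconfiguration M₁ M₂ public

-- Use the sets of the cover one after another.  For a chosen set S, the chain
-- s_S^1, …, s_S^{L+1} is first shifted up by one position, alternating exchanges in B₂ and
-- in B₁ (L exchanges); this frees s_S^1.  Every u ∈ S whose e_u^1 and e_u^2 have not been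
-- exchanged yet is then handled with seven exchanges: s_S^1 takes the place of c_u^{id(u,S)}
-- in B₂, so e_u^3 can leave B₁ and carry e_u^1 and e_u^2 past each other.  Finally the shift is
-- undone by running it backwards (L more exchanges), as reconfiguration sequences can be
-- reversed.  At most k sets and n elements give at most 2kL + 7n exchanges.

module Submission where

open import Defs
open import Data.Bool using (Bool; true; false; if_then_else_; _∧_; not)
open import Data.Bool.ListAction using (any)
open import Data.Bool.Properties using (∧-conicalˡ; ∧-conicalʳ; T-≡)
open import Data.Fin using (Fin; toℕ) renaming (zero to fzero; suc to fsuc)
open import Data.Fin.Properties using (toℕ-injective) renaming (_≟_ to _≟ᶠ_)
open import Data.Fin.Subset using (Subset; ∣_∣; ⊥)
open import Data.Fin.Subset.Properties using (∣⊥∣≡0; ∣p∣≤n)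
open import Data.List using (List; []; _∷_; _++_; map; length; filterᵇ; allFin)
open import Data.List.Membership.Propositional using (_∈_; _∉_; find; lose)
open import Data.List.Membership.Propositional.Properties
  using (∈-map⁺; ∈-map⁻; ∈-filter⁺; ∈-filter⁻; ∈-++⁺ˡ; ∈-++⁺ʳ; ∈-++⁻;
         ∈-concatMap⁺; ∈-concatMap⁻; ∈-upTo⁺; ∈-upTo⁻; ∈-allFin)
open import Data.List.Properties using (filter-++; length-++)
import Data.List.Relation.Unary.All as All
open import Data.List.Relation.Unary.All.Properties using (All¬⇒¬Any)
open import Data.List.Relation.Unary.AllPairs using (_∷_)
open import Data.List.Relation.Unary.Any using (here; there)
open import Data.List.Relation.Unary.Any.Properties using (any⁺; any⁻)
open import Data.List.Relation.Unary.Unique.Propositional using (Unique)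
import Data.List.Relation.Unary.Unique.Propositional.Properties as Unique
open import Data.Nat using (ℕ; zero; suc; _+_; _*_; _∸_; _≤_; _<_; _≤ᵇ_; _≡ᵇ_; z≤n; s≤s)
open import Data.Nat.Properties
  using (+-assoc; +-suc; +-identityʳ; +-cancelʳ-≡; *-suc; +-monoʳ-≤; +-monoˡ-≤; *-monoʳ-≤;
         *-monoˡ-≤; m≤n⇒m≤1+n; ≤-refl; ≤-trans; <⇒≤; <⇒≱; <⇒≢; <-cmp; _≤?_; ≤ᵇ⇒≤; ≡ᵇ⇒≡; ≡⇒≡ᵇ;
         suc-injective; module ≤-Reasoning)
  renaming (_≟_ to _≟ℕ_)
open import Data.Nat.Tactic.RingSolver using (solve-∀)
open import Data.Product using (Σ; ∃; _×_; _,_; proj₁; proj₂)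
open import Data.Sum using (_⊎_; inj₁; inj₂; [_,_])
open import Data.Vec using (lookup; _[_]≔_)
import Data.Vec as Vec
open import Data.Vec.Properties using (lookup∘update; lookup∘update′; lookup-replicate)
open import Function using (_∘_; id; case_of_)
open import Function.Bundles using (mk⇔; Equivalence)
open import Function.Definitions using (Injective)
open import Relation.Binary.Definitions using (DecidableEquality; tri<; tri≈; tri>)
open import Relation.Binary.PropositionalEquality
  using (_≡_; refl; sym; trans; cong; cong₂; subst; module ≡-Reasoning)
open import Relation.Nullary using (¬_; yes; no; does; contradiction)
open import Relation.Nullary.Decidable using (dec-true; dec-false; map′; _×-dec_; T?)

-- Counting in lists

module _ {A : Set} where

  count-++ : ∀ (B : SetOf A) xs ys → count B (xs ++ ys) ≡ count B xs + count B ys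
  count-++ B xs ys = trans (cong length (filter-++ (T? ∘ B) xs ys)) (length-++ (filterᵇ B xs))

  count-map-none : ∀ {C : Set} (B : SetOf A) (g : C → A) xs → (∀ x → B (g x) ≡ false) →
                   count B (map g xs) ≡ 0
  count-map-none B g [] _ = refl
  count-map-none B g (x ∷ xs) none rewrite none x = count-map-none B g xs none

  count-map-all : ∀ {C : Set} (B : SetOf A) (g : C → A) xs → (∀ x → x ∈ xs → B (g x) ≡ true) →
                  count B (map g xs) ≡ length xs
  count-map-all B g [] _ = refl
  count-map-all B g (x ∷ xs) all rewrite all x (here refl) =
    cong suc (count-map-all B g xs (λ y y∈ → all y (there y∈)))

  count-pos : ∀ {B : SetOf A} {x xs} → x ∈ xs → B x ≡ true → 0 < count B xs
  count-pos {B} {x} {y ∷ ys} (here refl) Bx rewrite Bx = s≤s z≤n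
  count-pos {B} {x} {y ∷ ys} (there x∈) Bx with B y
  ... | true = s≤s z≤n
  ... | false = count-pos x∈ Bx

  count-mono : ∀ {B B′ : SetOf A} → (∀ x → B x ≡ true → B′ x ≡ true) →
               ∀ xs → count B xs ≤ count B′ xs
  count-mono B⊆B′ [] = z≤n
  count-mono {B} {B′} B⊆B′ (x ∷ xs) with B x in Bx | B′ x in B′x
  ... | true | true = s≤s (count-mono B⊆B′ xs)
  ... | true | false = contradiction (trans (sym (B⊆B′ x Bx)) B′x) λ ()
  ... | false | true = m≤n⇒m≤1+n (count-mono B⊆B′ xs)
  ... | false | false = count-mono B⊆B′ xs

  count-strict : ∀ {B B′ : SetOf A} {x xs} → (∀ x → B x ≡ true → B′ x ≡ true) →
                 x ∈ xs → B x ≡ false → B′ x ≡ true → count B xs < count B′ xs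
  count-strict {B} {B′} {x} {y ∷ ys} B⊆B′ (here refl) Bx B′x rewrite Bx | B′x =
    s≤s (count-mono B⊆B′ ys)
  count-strict {B} {B′} {x} {y ∷ ys} B⊆B′ (there x∈) Bx B′x with B y in By | B′ y in B′y
  ... | true | true = s≤s (count-strict B⊆B′ x∈ Bx B′x)
  ... | true | false = contradiction (trans (sym (B⊆B′ y By)) B′y) λ ()
  ... | false | true = m≤n⇒m≤1+n (count-strict B⊆B′ x∈ Bx B′x)
  ... | false | false = count-strict B⊆B′ x∈ Bx B′x

-- Exchanging single elements of bases of direct sums of uniform matroids

module BasisExchange {E : Set} (_≟_ : DecidableEquality E) where

  infix 4 _==_
  _==_ : E → E → Bool
  x == y = does (x ≟ y)

  replace : SetOf E → E → E → SetOf E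
  replace B x y z = if z == y then true else if z == x then false else B z

  occurrences : E → List E → ℕ
  occurrences x = count (_== x)

  occurrences-absent : ∀ {x xs} → x ∉ xs → occurrences x xs ≡ 0
  occurrences-absent {x} {[]} _ = refl
  occurrences-absent {x} {y ∷ ys} x∉ with y ≟ x
  ... | yes refl = contradiction (here refl) x∉
  ... | no _ = occurrences-absent (x∉ ∘ there)

  occurrences-unique : ∀ {x xs} → Unique xs → x ∈ xs → occurrences x xs ≡ 1
  occurrences-unique {x} (x≢ ∷ unique) (here refl) rewrite dec-true (x ≟ x) refl =
    cong suc (occurrences-absent (All¬⇒¬Any x≢))
  occurrences-unique {x} {y ∷ _} (y≢ ∷ unique) (there x∈) rewrite dec-false (y ≟ x) (All.lookup y≢ x∈) =
    occurrences-unique unique x∈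

  ≢-by-membership : ∀ {B : SetOf E} {x y} → B x ≡ true → B y ≡ false → ¬ y ≡ x
  ≢-by-membership Bx By refl = contradiction (trans (sym Bx) By) λ ()

  count-replace : ∀ {B x y} → B x ≡ true → B y ≡ false →
                  ∀ zs → count (replace B x y) zs + occurrences x zs ≡ count B zs + occurrences y zs
  count-replace Bx By [] = refl
  count-replace {B} {x} {y} Bx By (z ∷ zs) with z ≟ y
  ... | yes refl with y ≟ x
  ...   | yes y≡x = contradiction y≡x (≢-by-membership Bx By)
  ...   | no _ rewrite By = trans (cong suc (count-replace Bx By zs)) (sym (+-suc _ _))
  count-replace {B} {x} Bx By (z ∷ zs) | no _ with z ≟ x
  ...   | yes refl rewrite Bx = trans (+-suc _ _) (cong suc (count-replace Bx By zs))
  ...   | no _ with B z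
  ...     | true = cong suc (count-replace Bx By zs)
  ...     | false = count-replace Bx By zs

  replace-target : ∀ B x y → replace B x y y ≡ true
  replace-target B x y rewrite dec-true (y ≟ y) refl = refl

  replace-other : ∀ B x y {z} → ¬ z ≡ x → ¬ z ≡ y → replace B x y z ≡ B z
  replace-other B x y {z} z≢x z≢y rewrite dec-false (z ≟ y) z≢y | dec-false (z ≟ x) z≢x = refl

  replace-source : ∀ B x y → ¬ x ≡ y → replace B x y x ≡ false
  replace-source B x y x≢y rewrite dec-false (x ≟ y) x≢y | dec-true (x ≟ x) refl = refl

  module _ (bs : List (Block E)) where

    Interchangeable : E → E → Set
    Interchangeable x y = ∀ b → b ∈ bs → occurrences x (proj₁ b) ≡ occurrences y (proj₁ b)

    interchangeable-sym : ∀ {x y} → Interchangeable x y → Interchangeable y x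
    interchangeable-sym x⇄y b b∈ = sym (x⇄y b b∈)

    basis-replace : ∀ {B x y} → IsBasis bs B → B x ≡ true → B y ≡ false → InGround bs y →
                    Interchangeable x y → IsBasis bs (replace B x y)
    basis-replace {B} {x} {y} (ground , rank) Bx By y∈ x⇄y = ground′ , rank′
      where
        ground′ : ∀ z → replace B x y z ≡ true → InGround bs z
        ground′ z Bz with z ≟ y
        ... | yes refl = y∈
        ... | no _ with z ≟ x
        ...   | yes _ = contradiction Bz λ ()
        ...   | no _ = ground z Bz
        rank′ : ∀ b → b ∈ bs → count (replace B x y) (proj₁ b) ≡ proj₂ b
        rank′ b b∈ = trans (+-cancelʳ-≡ _ _ _ (trans (count-replace Bx By (proj₁ b))
                                                      (cong (count B (proj₁ b) +_) (sym (x⇄y b b∈)))))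
                           (rank b b∈)

    exchange-replace : ∀ {B x y} → B x ≡ true → InGround bs y → B y ≡ false →
                       Exchange bs B (replace B x y)
    exchange-replace {B} {x} {y} Bx y∈ By = x , y , Bx , y∈ , By , λ z → mk⇔ (to z) (from z)
      where
        to : ∀ z → replace B x y z ≡ true → (z ≡ y) ⊎ ((B z ≡ true) × ¬ z ≡ x)
        to z Bz with z ≟ y
        ... | yes z≡y = inj₁ z≡y
        ... | no _ with z ≟ x
        ...   | yes _ = contradiction Bz λ ()
        ...   | no z≢x = inj₂ (Bz , z≢x)
        from : ∀ z → (z ≡ y) ⊎ ((B z ≡ true) × ¬ z ≡ x) → replace B x y z ≡ true
        from z (inj₁ refl) = replace-target B x z
        from z (inj₂ (Bz , z≢x)) with z ≟ y
        ... | yes _ = refl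
        ... | no _ rewrite dec-false (z ≟ x) z≢x = Bz

    exchange-sym : ∀ {B B′} → IsBasis bs B → Exchange bs B B′ → Exchange bs B′ B
    exchange-sym {B} {B′} (ground , _) (x , y , Bx , y∈ , By , B′≡) =
      y , x , B′y , ground x Bx , B′x , λ z → mk⇔ (to z) (from z)
      where
        B′y : B′ y ≡ true
        B′y = Equivalence.from (B′≡ y) (inj₁ refl)
        B′x : B′ x ≡ false
        B′x with B′ x in B′x≡ | Equivalence.to (B′≡ x)
        ... | false | _ = refl
        ... | true | B′x→ with B′x→ refl
        ...   | inj₁ x≡y = contradiction (sym x≡y) (≢-by-membership Bx By)
        ...   | inj₂ (_ , x≢x) = contradiction refl x≢x
        to : ∀ z → B z ≡ true → (z ≡ x) ⊎ ((B′ z ≡ true) × ¬ z ≡ y)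
        to z Bz with z ≟ x
        ... | yes z≡x = inj₁ z≡x
        ... | no z≢x = inj₂ (Equivalence.from (B′≡ z) (inj₂ (Bz , z≢x)) , ≢-by-membership Bz By ∘ sym)
        from : ∀ z → (z ≡ x) ⊎ ((B′ z ≡ true) × ¬ z ≡ y) → B z ≡ true
        from z (inj₁ refl) = Bx
        from z (inj₂ (B′z , z≢y)) with Equivalence.to (B′≡ z) B′z
        ... | inj₁ z≡y = contradiction z≡y z≢y
        ... | inj₂ (Bz , _) = Bz

    exchange-congˡ : ∀ {B₀ B B′} → SameSet B₀ B → Exchange bs B B′ → Exchange bs B₀ B′
    exchange-congˡ {B₀} {B} {B′} B₀≗B (x , y , Bx , y∈ , By , B′≡) =
      x , y , trans (B₀≗B x) Bx , y∈ , trans (B₀≗B y) By ,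
      λ z → mk⇔ (Data.Sum.map₂ (Data.Product.map₁ (trans (B₀≗B z))) ∘ Equivalence.to (B′≡ z))
                (Equivalence.from (B′≡ z) ∘ Data.Sum.map₂ (Data.Product.map₁ (trans (sym (B₀≗B z)))))

    basis-cong : ∀ {B B′} → SameSet B B′ → IsBasis bs B → IsBasis bs B′
    basis-cong {B} {B′} B≗B′ (ground , rank) =
      (λ z B′z → ground z (trans (B≗B′ z) B′z)) ,
      λ b b∈ → trans (sym (count-cong (proj₁ b))) (rank b b∈)
      where
        count-cong : ∀ zs → count B zs ≡ count B′ zs
        count-cong [] = refl
        count-cong (z ∷ zs) rewrite B≗B′ z with B′ z
        ... | true = cong suc (count-cong zs)
        ... | false = count-cong zs

  module Paths (M₁ M₂ : List (Block E)) where
    open Reconfiguration M₁ M₂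

    sameConfig-refl : ∀ {P} → SameConfig P P
    sameConfig-refl = (λ _ → refl) , (λ _ → refl)

    sameConfig-sym : ∀ {P Q} → SameConfig P Q → SameConfig Q P
    sameConfig-sym (B₁≗ , B₂≗) = (λ z → sym (B₁≗ z)) , (λ z → sym (B₂≗ z))

    sameConfig-trans : ∀ {P Q R} → SameConfig P Q → SameConfig Q R → SameConfig P R
    sameConfig-trans (B₁≗ , B₂≗) (B₁≗′ , B₂≗′) =
      (λ z → trans (B₁≗ z) (B₁≗′ z)) , (λ z → trans (B₂≗ z) (B₂≗′ z))

    feasible-cong : ∀ {P Q} → SameConfig P Q → Feasible P → Feasible Q
    feasible-cong (B₁≗ , B₂≗) (basis₁ , basis₂ , disjoint) =
      basis-cong M₁ B₁≗ basis₁ , basis-cong M₂ B₂≗ basis₂ ,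
      λ z B₁z → trans (sym (B₂≗ z)) (disjoint z (trans (B₁≗ z) B₁z))

    adjacent-congˡ : ∀ {P Q R} → SameConfig P Q → Adjacent Q R → Adjacent P R
    adjacent-congˡ (B₁≗ , B₂≗) (inj₁ (ex , B₂≗′)) =
      inj₁ (exchange-congˡ M₁ B₁≗ ex , λ z → trans (B₂≗ z) (B₂≗′ z))
    adjacent-congˡ (B₁≗ , B₂≗) (inj₂ (B₁≗′ , ex)) =
      inj₂ ((λ z → trans (B₁≗ z) (B₁≗′ z)) , exchange-congˡ M₂ B₂≗ ex)

    adjacent-sym : ∀ {P Q} → Feasible P → Adjacent P Q → Adjacent Q P
    adjacent-sym (basis₁ , _) (inj₁ (ex , B₂≗)) =
      inj₁ (exchange-sym M₁ basis₁ ex , λ z → sym (B₂≗ z))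
    adjacent-sym (_ , basis₂ , _) (inj₂ (B₁≗ , ex)) =
      inj₂ ((λ z → sym (B₁≗ z)) , exchange-sym M₂ basis₂ ex)

    source-feasible : ∀ {ℓ P Q} → Reconf ℓ P Q → Feasible P
    source-feasible (done FP _) = FP
    source-feasible (step FP _ _) = FP

    target-feasible : ∀ {ℓ P Q} → Reconf ℓ P Q → Feasible Q
    target-feasible (done FP P≈Q) = feasible-cong P≈Q FP
    target-feasible (step _ _ r) = target-feasible r

    reconf-congˡ : ∀ {ℓ P Q R} → SameConfig P Q → Reconf ℓ Q R → Reconf ℓ P R
    reconf-congˡ P≈Q (done FQ Q≈R) =
      done (feasible-cong (sameConfig-sym P≈Q) FQ) (sameConfig-trans P≈Q Q≈R)
    reconf-congˡ P≈Q (step FQ adj r) =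
      step (feasible-cong (sameConfig-sym P≈Q) FQ) (adjacent-congˡ P≈Q adj) r

    infixr 5 _++ᴿ_
    _++ᴿ_ : ∀ {a b P Q R} → Reconf a P Q → Reconf b Q R → Reconf (a + b) P R
    done _ P≈Q ++ᴿ r = reconf-congˡ P≈Q r
    step FP adj r ++ᴿ r′ = step FP adj (r ++ᴿ r′)

    reverse : ∀ {ℓ P Q} → Reconf ℓ P Q → Reconf ℓ Q P
    reverse {ℓ} {P} {Q} r =
      subst (λ k → Reconf k Q P) (+-identityʳ ℓ) (reverseOnto r (done (source-feasible r) sameConfig-refl))
      where
        reverseOnto : ∀ {a b P Q S} → Reconf a P Q → Reconf b P S → Reconf (a + b) Q S
        reverseOnto (done _ P≈Q) acc = reconf-congˡ (sameConfig-sym P≈Q) acc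
        reverseOnto {suc a} {b} {Q = Q} {S} (step FP adj r) acc =
          subst (λ k → Reconf k Q S) (+-suc a b)
                (reverseOnto r (step (source-feasible r) (adjacent-sym FP adj) acc))

    infix 4 _⇝⟨_⟩_
    _⇝⟨_⟩_ : Config → ℕ → Config → Set
    P ⇝⟨ ℓ ⟩ Q = Feasible P → Reconf ℓ P Q

    ⇝-same : ∀ {P Q} → SameConfig P Q → P ⇝⟨ 0 ⟩ Q
    ⇝-same P≈Q FP = done FP P≈Q

    infixr 5 _⨾_
    _⨾_ : ∀ {a b P Q R} → P ⇝⟨ a ⟩ Q → Q ⇝⟨ b ⟩ R → P ⇝⟨ a + b ⟩ R
    (p ⨾ q) FP = let r = p FP in r ++ᴿ q (target-feasible r)

    ⇝-reverse : ∀ {ℓ P Q} → Feasible P → P ⇝⟨ ℓ ⟩ Q → Q ⇝⟨ ℓ ⟩ P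
    ⇝-reverse FP p _ = reverse (p FP)

    move₁ : ∀ {B₁ B₂ x y} → B₁ x ≡ true → B₁ y ≡ false → B₂ y ≡ false → InGround M₁ y →
            Interchangeable M₁ x y → (B₁ , B₂) ⇝⟨ 1 ⟩ (replace B₁ x y , B₂)
    move₁ {B₁} {B₂} {x} {y} B₁x B₁y B₂y y∈ x⇄y FP@(basis₁ , basis₂ , disjoint) =
      step FP (inj₁ (exchange-replace M₁ B₁x y∈ B₁y , λ _ → refl))
           (done (basis-replace M₁ basis₁ B₁x B₁y y∈ x⇄y , basis₂ , disjoint′) sameConfig-refl)
      where
        disjoint′ : ∀ z → replace B₁ x y z ≡ true → B₂ z ≡ false
        disjoint′ z B₁′z with z ≟ y
        ... | yes refl = B₂y
        ... | no _ with z ≟ x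
        ...   | yes _ = contradiction B₁′z λ ()
        ...   | no _ = disjoint z B₁′z

    move₂ : ∀ {B₁ B₂ x y} → B₂ x ≡ true → B₂ y ≡ false → B₁ y ≡ false → InGround M₂ y →
            Interchangeable M₂ x y → (B₁ , B₂) ⇝⟨ 1 ⟩ (B₁ , replace B₂ x y)
    move₂ {B₁} {B₂} {x} {y} B₂x B₂y B₁y y∈ x⇄y FP@(basis₁ , basis₂ , disjoint) =
      step FP (inj₂ ((λ _ → refl) , exchange-replace M₂ B₂x y∈ B₂y))
           (done (basis₁ , basis-replace M₂ basis₂ B₂x B₂y y∈ x⇄y , disjoint′) sameConfig-refl)
      where
        disjoint′ : ∀ z → B₁ z ≡ true → replace B₂ x y z ≡ false
        disjoint′ z B₁z with z ≟ y
        ... | yes refl = contradiction (trans (sym B₁z) B₁y) λ ()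
        ... | no _ with z ≟ x
        ...   | yes _ = refl
        ...   | no _ = disjoint z B₁z

true⇔true⇒≡ : ∀ {a b : Bool} → (a ≡ true → b ≡ true) → (b ≡ true → a ≡ true) → a ≡ b
true⇔true⇒≡ {false} {false} _ _ = refl
true⇔true⇒≡ {false} {true} _ b→a = b→a refl
true⇔true⇒≡ {true} {false} a→b _ = sym (a→b refl)
true⇔true⇒≡ {true} {true} _ _ = refl

cost-trans : ∀ s₁ s₂ b b′ {d d₁ d₂} → s₁ + d ≡ b + d₁ → s₂ + d₁ ≡ b′ + d₂ →
             (s₁ + s₂) + d ≡ (b + b′) + d₂
cost-trans s₁ s₂ b b′ {d} {d₁} {d₂} e₁ e₂ = begin
  (s₁ + s₂) + d  ≡⟨ rearrange s₁ s₂ d ⟩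
  s₂ + (s₁ + d)  ≡⟨ cong (s₂ +_) e₁ ⟩
  s₂ + (b + d₁)  ≡⟨ swap s₂ b d₁ ⟩
  b + (s₂ + d₁)  ≡⟨ cong (b +_) e₂ ⟩
  b + (b′ + d₂)  ≡⟨ +-assoc b b′ d₂ ⟨
  (b + b′) + d₂  ∎
  where
    open ≡-Reasoning
    rearrange : ∀ x y z → (x + y) + z ≡ y + (x + z)
    rearrange = solve-∀
    swap : ∀ x y z → x + (y + z) ≡ y + (x + z)
    swap = solve-∀

insert-grows : ∀ {k} (D : Subset k) u v → lookup D v ≡ true → lookup (D [ u ]≔ true) v ≡ true
insert-grows D u v Dv with v ≟ᶠ u
... | yes refl = lookup∘update u D true
... | no v≢u = trans (lookup∘update′ v≢u D true) Dv

insert-size : ∀ {k} (D : Subset k) u → lookup D u ≡ false → ∣ D [ u ]≔ true ∣ ≡ suc ∣ D ∣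
insert-size (false Vec.∷ D) fzero refl = refl
insert-size (true Vec.∷ D) (fsuc u) Du = cong suc (insert-size D u Du)
insert-size (false Vec.∷ D) (fsuc u) Du = insert-size D u Du

-- Shifting a chain of tokens

double : ℕ → ℕ
double zero = zero
double (suc p) = suc (suc (double p))

double-≢-odd : ∀ a b → (double a ≡ᵇ suc (double b)) ≡ false
double-≢-odd zero b = refl
double-≢-odd (suc a) zero = refl
double-≢-odd (suc a) (suc b) = double-≢-odd a b

odd-≢-double : ∀ a b → (suc (double a) ≡ᵇ double b) ≡ false
odd-≢-double a zero = refl
odd-≢-double a (suc b) = double-≢-odd a b

2*≡double : ∀ p → 2 * p ≡ double p
2*≡double zero = refl
2*≡double (suc p) = trans (*-suc 2 p) (cong (suc ∘ suc) (2*≡double p))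

open BasisExchange _≟ℕ_ using () renaming (replace to replaceℕ)

-- The chain of N tokens in state q: token p occupies position 2p if p < q, and 2p+1 otherwise.
tokens : ℕ → ℕ → ℕ → Bool
tokens zero q z = false
tokens (suc N) zero zero = false
tokens (suc N) zero (suc zero) = true
tokens (suc N) zero (suc (suc z)) = tokens N zero z
tokens (suc N) (suc q) zero = true
tokens (suc N) (suc q) (suc zero) = false
tokens (suc N) (suc q) (suc (suc z)) = tokens N q z

tokens-step : ∀ {N p} → p < N →
              ∀ z → replaceℕ (tokens N (suc p)) (double p) (suc (double p)) z ≡ tokens N p z
tokens-step {suc N} {zero} _ zero = refl
tokens-step {suc N} {zero} _ (suc zero) = refl
tokens-step {suc N} {zero} _ (suc (suc z)) = refl
tokens-step {suc N} {suc p} _ zero = refl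
tokens-step {suc N} {suc p} _ (suc zero) = refl
tokens-step {suc N} {suc p} (s≤s p<N) (suc (suc z)) = tokens-step p<N z

tokens-unmoved : ∀ {N q p} → p < q → p < N → tokens N q (double p) ≡ true
tokens-unmoved {suc N} {suc q} {zero} _ _ = refl
tokens-unmoved {suc N} {suc q} {suc p} (s≤s p<q) (s≤s p<N) = tokens-unmoved p<q p<N

tokens-vacated : ∀ {N q p} → q ≤ p → tokens N q (double p) ≡ false
tokens-vacated {zero} _ = refl
tokens-vacated {suc N} {zero} {zero} _ = refl
tokens-vacated {suc N} {zero} {suc p} _ = tokens-vacated {N} {zero} {p} z≤n
tokens-vacated {suc N} {suc q} {suc p} (s≤s q≤p) = tokens-vacated {N} q≤p

tokens-unoccupied : ∀ {N q p} → p < q → tokens N q (suc (double p)) ≡ false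
tokens-unoccupied {zero} _ = refl
tokens-unoccupied {suc N} {suc q} {zero} _ = refl
tokens-unoccupied {suc N} {suc q} {suc p} (s≤s p<q) = tokens-unoccupied {N} p<q

tokens-at-rest : ∀ {N z} → tokens N N z ≡ true → Σ ℕ λ p → p < N × z ≡ double p
tokens-at-rest {suc N} {zero} _ = zero , s≤s z≤n , refl
tokens-at-rest {suc N} {suc (suc z)} occupied with tokens-at-rest {N} {z} occupied
... | p , p<N , refl = suc p , s≤s p<N , refl

-- The reconfiguration sequence

module Sequence (n m : ℕ) (𝒮 : Fin m → Subset n) where
  open Construction n m 𝒮

  N : ℕ
  N = n * n

  c-injective : ∀ {u v k l} → c u k ≡ c v l → u ≡ v × k ≡ l
  c-injective refl = refl , refl

  s-injective : ∀ {j i a b} → s j a ≡ s i b → j ≡ i × a ≡ b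
  s-injective refl = refl , refl

  infix 4 _≟ᴱ_
  _≟ᴱ_ : DecidableEquality Elem
  e¹ u ≟ᴱ e¹ v = map′ (cong e¹) (λ { refl → refl }) (u ≟ᶠ v)
  e² u ≟ᴱ e² v = map′ (cong e²) (λ { refl → refl }) (u ≟ᶠ v)
  e³ u ≟ᴱ e³ v = map′ (cong e³) (λ { refl → refl }) (u ≟ᶠ v)
  c u k ≟ᴱ c v l = map′ (λ (u≡v , k≡l) → cong₂ c u≡v k≡l) c-injective
                        (u ≟ᶠ v ×-dec k ≟ℕ l)
  s j a ≟ᴱ s i b = map′ (λ (j≡i , a≡b) → cong₂ s j≡i a≡b) s-injective
                        (j ≟ᶠ i ×-dec a ≟ℕ b)
  e¹ _ ≟ᴱ e² _ = no λ ()
  e¹ _ ≟ᴱ e³ _ = no λ ()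
  e¹ _ ≟ᴱ c _ _ = no λ ()
  e¹ _ ≟ᴱ s _ _ = no λ ()
  e² _ ≟ᴱ e¹ _ = no λ ()
  e² _ ≟ᴱ e³ _ = no λ ()
  e² _ ≟ᴱ c _ _ = no λ ()
  e² _ ≟ᴱ s _ _ = no λ ()
  e³ _ ≟ᴱ e¹ _ = no λ ()
  e³ _ ≟ᴱ e² _ = no λ ()
  e³ _ ≟ᴱ c _ _ = no λ ()
  e³ _ ≟ᴱ s _ _ = no λ ()
  c _ _ ≟ᴱ e¹ _ = no λ ()
  c _ _ ≟ᴱ e² _ = no λ ()
  c _ _ ≟ᴱ e³ _ = no λ ()
  c _ _ ≟ᴱ s _ _ = no λ ()
  s _ _ ≟ᴱ e¹ _ = no λ ()
  s _ _ ≟ᴱ e² _ = no λ ()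
  s _ _ ≟ᴱ e³ _ = no λ ()
  s _ _ ≟ᴱ c _ _ = no λ ()

  open BasisExchange _≟ᴱ_
  open Paths M₁ M₂

  data M₁-Block : Block Elem → Set where
    Mu1-block : ∀ u → M₁-Block (Mu1 u)
    Mu3-block : ∀ u → M₁-Block (Mu3 u)
    link₁ : ∀ j p → p < N → M₁-Block (MSi j (suc (double p)))

  data M₂-Block : Block Elem → Set where
    Mu2-block : ∀ u → M₂-Block (Mu2 u)
    MS0-block : ∀ j → M₂-Block (MS0 j)
    link₂ : ∀ j p → p < N → M₂-Block (MSi j (double (suc p)))

  ∈M₁⇒M₁-Block : ∀ {b} → b ∈ M₁ → M₁-Block b
  ∈M₁⇒M₁-Block b∈ with ∈-++⁻ (map Mu1 (allFin n)) b∈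
  ... | inj₁ b∈Mu1 with _ , _ , refl ← ∈-map⁻ Mu1 b∈Mu1 = Mu1-block _
  ... | inj₂ b∈rest with ∈-++⁻ (map Mu3 (allFin n)) b∈rest
  ...   | inj₁ b∈Mu3 with _ , _ , refl ← ∈-map⁻ Mu3 b∈Mu3 = Mu3-block _
  ...   | inj₂ b∈links with j , _ , b∈j ← find (∈-concatMap⁻ _ {xs = allFin m} b∈links)
                         with _ , i∈ , refl ← ∈-map⁻ _ b∈j
                         with p , p∈ , refl ← ∈-map⁻ suc i∈
    = subst (λ i → M₁-Block (MSi j i)) (sym (cong (_∸ 1) (2*≡double (suc p))))
            (link₁ j p (∈-upTo⁻ p∈))

  ∈M₂⇒M₂-Block : ∀ {b} → b ∈ M₂ → M₂-Block b
  ∈M₂⇒M₂-Block b∈ with ∈-++⁻ (map Mu2 (allFin n)) b∈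
  ... | inj₁ b∈Mu2 with _ , _ , refl ← ∈-map⁻ Mu2 b∈Mu2 = Mu2-block _
  ... | inj₂ b∈rest with ∈-++⁻ (map MS0 (allFin m)) b∈rest
  ...   | inj₁ b∈MS0 with _ , _ , refl ← ∈-map⁻ MS0 b∈MS0 = MS0-block _
  ...   | inj₂ b∈links with j , _ , b∈j ← find (∈-concatMap⁻ _ {xs = allFin m} b∈links)
                         with _ , i∈ , refl ← ∈-map⁻ _ b∈j
                         with p , p∈ , refl ← ∈-map⁻ suc i∈
    = subst (λ i → M₂-Block (MSi j i)) (sym (2*≡double (suc p))) (link₂ j p (∈-upTo⁻ p∈))

  M₁-Block⇒∈M₁ : ∀ {b} → M₁-Block b → b ∈ M₁
  M₁-Block⇒∈M₁ (Mu1-block u) = ∈-++⁺ˡ (∈-map⁺ Mu1 (∈-allFin u))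
  M₁-Block⇒∈M₁ (Mu3-block u) = ∈-++⁺ʳ (map Mu1 (allFin n)) (∈-++⁺ˡ (∈-map⁺ Mu3 (∈-allFin u)))
  M₁-Block⇒∈M₁ (link₁ j p p<N) =
    ∈-++⁺ʳ (map Mu1 (allFin n)) (∈-++⁺ʳ (map Mu3 (allFin n)) (∈-concatMap⁺ _ (lose (∈-allFin j)
      (subst (λ i → MSi j i ∈ map (λ i → MSi j (2 * i ∸ 1)) (oneTo N)) (cong (_∸ 1) (2*≡double (suc p)))
             (∈-map⁺ (λ i → MSi j (2 * i ∸ 1)) (∈-map⁺ suc (∈-upTo⁺ p<N)))))))

  M₂-Block⇒∈M₂ : ∀ {b} → M₂-Block b → b ∈ M₂
  M₂-Block⇒∈M₂ (Mu2-block u) = ∈-++⁺ˡ (∈-map⁺ Mu2 (∈-allFin u))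
  M₂-Block⇒∈M₂ (MS0-block j) = ∈-++⁺ʳ (map Mu2 (allFin n)) (∈-++⁺ˡ (∈-map⁺ MS0 (∈-allFin j)))
  M₂-Block⇒∈M₂ (link₂ j p p<N) =
    ∈-++⁺ʳ (map Mu2 (allFin n)) (∈-++⁺ʳ (map MS0 (allFin m)) (∈-concatMap⁺ _ (lose (∈-allFin j)
      (subst (λ i → MSi j i ∈ map (λ i → MSi j (2 * i)) (oneTo N)) (2*≡double (suc p))
             (∈-map⁺ (λ i → MSi j (2 * i)) (∈-map⁺ suc (∈-upTo⁺ p<N)))))))

  inGround₁ : ∀ {b z} → M₁-Block b → z ∈ proj₁ b → InGround M₁ z
  inGround₁ block z∈ = _ , M₁-Block⇒∈M₁ block , z∈

  inGround₂ : ∀ {b z} → M₂-Block b → z ∈ proj₁ b → InGround M₂ z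
  inGround₂ block z∈ = _ , M₂-Block⇒∈M₂ block , z∈

  interchangeable₁ : ∀ {x y} →
                     (∀ {b} → M₁-Block b → occurrences x (proj₁ b) ≡ occurrences y (proj₁ b)) →
                     Interchangeable M₁ x y
  interchangeable₁ same b b∈ = same (∈M₁⇒M₁-Block b∈)

  interchangeable₂ : ∀ {x y} →
                     (∀ {b} → M₂-Block b → occurrences x (proj₁ b) ≡ occurrences y (proj₁ b)) →
                     Interchangeable M₂ x y
  interchangeable₂ same b b∈ = same (∈M₂⇒M₂-Block b∈)

  idx-positive : ∀ {u j} → memb j u ≡ true → 0 < idx u j
  idx-positive {u} {j} u∈j =
    count-pos (∈-allFin j) (cong₂ _∧_ (dec-true (toℕ j ≤? toℕ j) ≤-refl) u∈j)

  idx≤f : ∀ u j → idx u j ≤ f u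
  idx≤f u j = count-mono (λ j′ → ∧-conicalʳ _ _) (allFin m)

  idx-increasing : ∀ {u j j′} → toℕ j < toℕ j′ → memb j′ u ≡ true → idx u j < idx u j′
  idx-increasing {u} {j} {j′} j<j′ u∈j′ =
    count-strict earlier (∈-allFin j′)
                 (cong (_∧ memb j′ u) (dec-false (toℕ j′ ≤? toℕ j) (<⇒≱ j<j′)))
                 (cong₂ _∧_ (dec-true (toℕ j′ ≤? toℕ j′) ≤-refl) u∈j′)
    where
      earlier : ∀ i → ((toℕ i ≤ᵇ toℕ j) ∧ memb i u) ≡ true →
                      ((toℕ i ≤ᵇ toℕ j′) ∧ memb i u) ≡ true
      earlier i i≤j∧u∈i =
        cong₂ _∧_ (dec-true (toℕ i ≤? toℕ j′) (≤-trans i≤j (<⇒≤ j<j′))) (∧-conicalʳ _ _ i≤j∧u∈i)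
        where
          i≤j : toℕ i ≤ toℕ j
          i≤j = ≤ᵇ⇒≤ _ _ (Equivalence.from T-≡ (∧-conicalˡ _ _ i≤j∧u∈i))

  idx-injective : ∀ {u j j′} → memb j u ≡ true → memb j′ u ≡ true →
                  idx u j ≡ idx u j′ → j ≡ j′
  idx-injective {u} {j} {j′} u∈j u∈j′ same with <-cmp (toℕ j) (toℕ j′)
  ... | tri< j<j′ _ _ = contradiction same (<⇒≢ (idx-increasing j<j′ u∈j′))
  ... | tri≈ _ j≡j′ _ = toℕ-injective j≡j′
  ... | tri> _ _ j′<j = contradiction (sym same) (<⇒≢ (idx-increasing j′<j u∈j))

  copies : Fin n → List Elem
  copies u = map (c u) (oneTo (f u))

  copiesIn : Fin m → List Elem
  copiesIn j = map (λ v → c v (idx v j)) (members j)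

  ∈-oneTo : ∀ {k K} → 0 < k → k ≤ K → k ∈ oneTo K
  ∈-oneTo {suc k} _ k<K = ∈-map⁺ suc (∈-upTo⁺ k<K)

  ∈-members : ∀ {u j} → memb j u ≡ true → u ∈ members j
  ∈-members {u} u∈j = ∈-filter⁺ (T? ∘ memb _) (∈-allFin u) (Equivalence.from T-≡ u∈j)

  ∈-members⁻ : ∀ {v j} → v ∈ members j → memb j v ≡ true
  ∈-members⁻ {j = j} v∈ = Equivalence.to T-≡ (proj₂ (∈-filter⁻ (T? ∘ memb j) {xs = allFin n} v∈))

  copies-unique : ∀ u → Unique (copies u)
  copies-unique u = Unique.map⁺ (proj₂ ∘ c-injective) (Unique.map⁺ suc-injective (Unique.upTo⁺ _))

  copiesIn-unique : ∀ j → Unique (copiesIn j)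
  copiesIn-unique j = Unique.map⁺ (proj₁ ∘ c-injective) (Unique.filter⁺ (T? ∘ memb j) (Unique.allFin⁺ n))

  c∈copies : ∀ {u j} → memb j u ≡ true → c u (idx u j) ∈ copies u
  c∈copies {u} {j} u∈j = ∈-map⁺ (c u) (∈-oneTo (idx-positive u∈j) (idx≤f u j))

  c∈copiesIn : ∀ {u j} → memb j u ≡ true → c u (idx u j) ∈ copiesIn j
  c∈copiesIn u∈j = ∈-map⁺ _ (∈-members u∈j)

  c∈copiesIn⇒≡ : ∀ {u j j′} → memb j u ≡ true → c u (idx u j) ∈ copiesIn j′ → j′ ≡ j
  c∈copiesIn⇒≡ u∈j c∈ with v , v∈ , eq ← ∈-map⁻ _ c∈ with c-injective eq
  ... | refl , idx≡ = idx-injective (∈-members⁻ v∈) u∈j (sym idx≡)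

  s∉copiesIn : ∀ {j a} j′ → s j a ∉ copiesIn j′
  s∉copiesIn j′ s∈ with _ , _ , () ← ∈-map⁻ _ s∈

  c∈MS0 : ∀ {u j} → memb j u ≡ true → c u (idx u j) ∈ proj₁ (MS0 j)
  c∈MS0 u∈j = ∈-++⁺ˡ (c∈copiesIn u∈j)

  s1∈MS0 : ∀ j → s j 1 ∈ proj₁ (MS0 j)
  s1∈MS0 j = ∈-++⁺ʳ (copiesIn j) (here refl)

  MS0-contents : ∀ {j z} → z ∈ proj₁ (MS0 j) →
                 (Σ (Fin n) λ v → memb j v ≡ true × z ≡ c v (idx v j)) ⊎ z ≡ s j 1
  MS0-contents {j} z∈ with ∈-++⁻ (copiesIn j) z∈
  ... | inj₁ z∈cs with v , v∈ , refl ← ∈-map⁻ _ z∈cs = inj₁ (v , ∈-members⁻ v∈ , refl)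
  ... | inj₂ (here z≡s) = inj₂ z≡s

  cMem-idx : ∀ {u j} → memb j u ≡ true → cMem u (idx u j) ≡ true
  cMem-idx {u} {j} u∈j = Equivalence.to T-≡ (any⁺ _ (lose (∈-allFin j)
    (Equivalence.from T-≡ (cong₂ _∧_ u∈j (Equivalence.to T-≡ (≡⇒≡ᵇ (idx u j) (idx u j) refl))))))

  cMem⁻ : ∀ {u k} → cMem u k ≡ true → Σ (Fin m) λ j → memb j u ≡ true × idx u j ≡ k
  cMem⁻ {u} {k} claimed with j , _ , found ← find (any⁻ _ (allFin m) (Equivalence.from T-≡ claimed)) =
    j , ∧-conicalˡ _ _ found′ , ≡ᵇ⇒≡ _ _ (Equivalence.from T-≡ (∧-conicalʳ _ _ found′))
    where
      found′ : (memb j u ∧ (idx u j ≡ᵇ k)) ≡ true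
      found′ = Equivalence.to T-≡ found

  copies-absent : ∀ {x} v → (∀ k → ¬ c v k ≡ x) → occurrences x (copies v) ≡ 0
  copies-absent {x} v c≢x = occurrences-absent {x} {copies v} λ x∈ →
    let (k , _ , x≡c) = ∈-map⁻ (c v) x∈ in c≢x k (sym x≡c)

  MS0-absent : ∀ {x} j → (∀ v k → ¬ c v k ≡ x) → ¬ s j 1 ≡ x → occurrences x (proj₁ (MS0 j)) ≡ 0
  MS0-absent j c≢x s≢x = occurrences-absent λ x∈ → case MS0-contents x∈ of λ where
    (inj₁ (v , _ , x≡c)) → c≢x v _ (sym x≡c)
    (inj₂ x≡s) → s≢x (sym x≡s)

  occurrences-MS0 : ∀ x j →
                    occurrences x (proj₁ (MS0 j)) ≡ occurrences x (copiesIn j) + occurrences x (s j 1 ∷ [])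
  occurrences-MS0 x j = count-++ (_== x) (copiesIn j) (s j 1 ∷ [])

  -- Splitting a pair exposes both membership tests to with-abstraction.
  occurrences-pair : ∀ x a b →
                     occurrences x (a ∷ b ∷ []) ≡ occurrences x (a ∷ []) + occurrences x (b ∷ [])
  occurrences-pair x a b = count-++ (_== x) (a ∷ []) (b ∷ [])

  e¹⇄e² : ∀ u → Interchangeable M₁ (e¹ u) (e² u)
  e¹⇄e² u = interchangeable₁ same
    where
      same : ∀ {b} → M₁-Block b → occurrences (e¹ u) (proj₁ b) ≡ occurrences (e² u) (proj₁ b)
      same (Mu1-block v) with v ≟ᶠ u
      ... | yes _ = refl
      ... | no _ = refl
      same (Mu3-block v) = trans (copies-absent v λ _ ()) (sym (copies-absent v λ _ ()))
      same (link₁ _ _ _) = refl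

  e³⇄c : ∀ {u j} → memb j u ≡ true → Interchangeable M₁ (e³ u) (c u (idx u j))
  e³⇄c {u} {j} u∈j = interchangeable₁ same
    where
      same : ∀ {b} → M₁-Block b → occurrences (e³ u) (proj₁ b) ≡ occurrences (c u (idx u j)) (proj₁ b)
      same (Mu1-block v) = refl
      same (Mu3-block v) with v ≟ᶠ u
      ... | yes refl = trans (cong suc (copies-absent u λ _ ()))
                             (sym (occurrences-unique (copies-unique u) (c∈copies u∈j)))
      ... | no v≢u = trans (copies-absent v λ _ ()) (sym (copies-absent v λ { _ refl → v≢u refl }))
      same (link₁ _ _ _) = refl

  e²⇄e³ : ∀ u → Interchangeable M₂ (e² u) (e³ u)
  e²⇄e³ u = interchangeable₂ same
    where
      same : ∀ {b} → M₂-Block b → occurrences (e² u) (proj₁ b) ≡ occurrences (e³ u) (proj₁ b)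
      same (Mu2-block v) with v ≟ᶠ u
      ... | yes _ = refl
      ... | no _ = refl
      same (MS0-block j) = trans (MS0-absent j (λ _ _ ()) (λ ())) (sym (MS0-absent j (λ _ _ ()) (λ ())))
      same (link₂ _ _ _) = refl

  e³⇄e¹ : ∀ u → Interchangeable M₂ (e³ u) (e¹ u)
  e³⇄e¹ u = interchangeable₂ same
    where
      same : ∀ {b} → M₂-Block b → occurrences (e³ u) (proj₁ b) ≡ occurrences (e¹ u) (proj₁ b)
      same (Mu2-block v) with v ≟ᶠ u
      ... | yes _ = refl
      ... | no _ = refl
      same (MS0-block j) = trans (MS0-absent j (λ _ _ ()) (λ ())) (sym (MS0-absent j (λ _ _ ()) (λ ())))
      same (link₂ _ _ _) = refl

  c⇄s : ∀ {u j} → memb j u ≡ true → Interchangeable M₂ (c u (idx u j)) (s j 1)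
  c⇄s {u} {j} u∈j = interchangeable₂ same
    where
      same : ∀ {b} → M₂-Block b → occurrences (c u (idx u j)) (proj₁ b) ≡ occurrences (s j 1) (proj₁ b)
      same (Mu2-block v) = refl
      same (MS0-block j′) rewrite occurrences-MS0 (c u (idx u j)) j′ | occurrences-MS0 (s j 1) j′
        with j′ ≟ᶠ j
      ... | yes refl = trans (cong (_+ 0) (occurrences-unique (copiesIn-unique j) (c∈copiesIn u∈j)))
                             (sym (cong (_+ 1) (occurrences-absent {s j 1} {copiesIn j} (s∉copiesIn j))))
      ... | no j′≢j = trans (cong (_+ 0) (occurrences-absent {c u (idx u j)} {copiesIn j′}
                                                               (j′≢j ∘ c∈copiesIn⇒≡ u∈j)))
                            (sym (cong (_+ 0) (occurrences-absent {s j 1} {copiesIn j′} (s∉copiesIn j′))))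
      same (link₂ j′ p _) = sym (occurrences-absent {s j 1} {proj₁ (MSi j′ (double (suc p)))}
                                                    λ { (here ()) ; (there (here ())) })

  link₁-shift : ∀ j p → Interchangeable M₁ (s j (suc (double p))) (s j (suc (suc (double p))))
  link₁-shift j p = interchangeable₁ same
    where
      x y : Elem
      x = s j (suc (double p))
      y = s j (suc (suc (double p)))
      same : ∀ {b} → M₁-Block b → occurrences x (proj₁ b) ≡ occurrences y (proj₁ b)
      same (Mu1-block _) = refl
      same (Mu3-block v) = trans (copies-absent v λ _ ()) (sym (copies-absent v λ _ ()))
      same (link₁ j′ p′ _)
        rewrite occurrences-pair x (s j′ (suc (double p′))) (s j′ (suc (suc (double p′))))
              | occurrences-pair y (s j′ (suc (double p′))) (s j′ (suc (suc (double p′))))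
        with j′ ≟ᶠ j
      ... | no _ = refl
      ... | yes refl rewrite odd-≢-double p′ p | double-≢-odd p′ p with double p′ ≡ᵇ double p
      ...   | true = refl
      ...   | false = refl

  link₂-shift : ∀ j p → Interchangeable M₂ (s j (suc (suc (double p)))) (s j (suc (suc (suc (double p)))))
  link₂-shift j p = interchangeable₂ same
    where
      x y : Elem
      x = s j (suc (suc (double p)))
      y = s j (suc (suc (suc (double p))))
      same : ∀ {b} → M₂-Block b → occurrences x (proj₁ b) ≡ occurrences y (proj₁ b)
      same (Mu2-block _) = refl
      same (MS0-block j′) = trans (MS0-absent j′ (λ _ _ ()) (λ ())) (sym (MS0-absent j′ (λ _ _ ()) (λ ())))
      same (link₂ j′ p′ _)
        rewrite occurrences-pair x (s j′ (suc (suc (double p′)))) (s j′ (suc (suc (suc (double p′)))))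
              | occurrences-pair y (s j′ (suc (suc (double p′)))) (s j′ (suc (suc (suc (double p′)))))
        with j′ ≟ᶠ j
      ... | no _ = refl
      ... | yes refl rewrite odd-≢-double p′ p | double-≢-odd p′ p with double p′ ≡ᵇ double p
      ...   | true = refl
      ...   | false = refl

  -- The chain of a set in state q, as seen from B₁ and from B₂: at rest (q = N) B₁ holds
  -- s^1, s^3, …, s^{2N-1} and B₂ holds s^2, s^4, …, s^{2N}; fully shifted (q = 0) every element
  -- has moved up by one, so that s^1 is in neither basis.
  track₁ track₂ : ℕ → ℕ → Bool
  track₁ q zero = false
  track₁ q (suc z) = tokens N q z
  track₂ q zero = false
  track₂ q (suc a) = track₁ q a

  track₁-step : ∀ {p} → p < N → ∀ a →
                replaceℕ (track₁ (suc p)) (suc (double p)) (suc (suc (double p))) a ≡ track₁ p a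
  track₁-step p<N zero = refl
  track₁-step p<N (suc z) = tokens-step p<N z

  track₂-step : ∀ {p} → p < N → ∀ a →
                replaceℕ (track₂ (suc p)) (suc (suc (double p))) (suc (suc (suc (double p)))) a ≡ track₂ p a
  track₂-step p<N zero = refl
  track₂-step p<N (suc a) = track₁-step p<N a

  side₁ side₂ : Subset n → (Fin m → ℕ) → SetOf Elem
  side₁ D σ (e¹ u) = not (lookup D u)
  side₁ D σ (e² u) = lookup D u
  side₁ D σ (e³ u) = true
  side₁ D σ (c u k) = false
  side₁ D σ (s j a) = track₁ (σ j) a
  side₂ D σ (e¹ u) = lookup D u
  side₂ D σ (e² u) = not (lookup D u)
  side₂ D σ (e³ u) = false
  side₂ D σ (c u k) = cMem u k
  side₂ D σ (s j a) = track₂ (σ j) a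

  -- In config D σ, e¹ and e² have been exchanged for the elements of D, and the chain of
  -- set j is in state σ j.
  config : Subset n → (Fin m → ℕ) → Config
  config D σ = side₁ D σ , side₂ D σ

  Lowers : Fin m → ℕ → (Fin m → ℕ) → (Fin m → ℕ) → Set
  Lowers j p σ σ′ = σ j ≡ suc p × σ′ j ≡ p × (∀ j′ → ¬ j′ ≡ j → σ′ j′ ≡ σ j′)

  side₁-lower : ∀ D {j p σ σ′} → p < N → Lowers j p σ σ′ →
                SameSet (replace (side₁ D σ) (s j (suc (double p))) (s j (suc (suc (double p))))) (side₁ D σ′)
  side₁-lower D _ _ (e¹ u) = refl
  side₁-lower D _ _ (e² u) = refl
  side₁-lower D _ _ (e³ u) = refl
  side₁-lower D _ _ (c u k) = refl
  side₁-lower D {j} p<N (σj , σ′j , elsewhere) (s j′ a) with j′ ≟ᶠ j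
  ... | yes refl rewrite σj | σ′j = track₁-step p<N a
  ... | no j′≢j rewrite elsewhere j′ j′≢j = refl

  side₂-lower : ∀ D {j p σ σ′} → p < N → Lowers j p σ σ′ →
                SameSet (replace (side₂ D σ) (s j (suc (suc (double p)))) (s j (suc (suc (suc (double p))))))
                        (side₂ D σ′)
  side₂-lower D _ _ (e¹ u) = refl
  side₂-lower D _ _ (e² u) = refl
  side₂-lower D _ _ (e³ u) = refl
  side₂-lower D _ _ (c u k) = refl
  side₂-lower D {j} p<N (σj , σ′j , elsewhere) (s j′ a) with j′ ≟ᶠ j
  ... | yes refl rewrite σj | σ′j = track₂-step p<N a
  ... | no j′≢j rewrite elsewhere j′ j′≢j = refl

  chain-step : ∀ D {j p σ σ′} → p < N → Lowers j p σ σ′ → config D σ ⇝⟨ 2 ⟩ config D σ′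
  chain-step D {j} {p} {σ} {σ′} p<N lowers@(σj , σ′j , _) =
    move₂ (occupied σj) (free σj) (vacated σj)
          (inGround₂ (link₂ j p p<N) (there (here refl))) (link₂-shift j p) ⨾
    ⇝-same ((λ _ → refl) , side₂-lower D p<N lowers) ⨾
    move₁ (occupied σj) (free σj) (vacated′ σ′j)
          (inGround₁ (link₁ j p p<N) (there (here refl))) (link₁-shift j p) ⨾
    ⇝-same (side₁-lower D p<N lowers , λ _ → refl)
    where
      occupied : ∀ {q} → q ≡ suc p → tokens N q (double p) ≡ true
      occupied refl = tokens-unmoved ≤-refl p<N
      free : ∀ {q} → q ≡ suc p → tokens N q (suc (double p)) ≡ false
      free refl = tokens-unoccupied {N} ≤-refl
      vacated : ∀ {q} → q ≡ suc p → tokens N q (double (suc p)) ≡ false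
      vacated refl = tokens-vacated {N} ≤-refl
      vacated′ : ∀ {q} → q ≡ p → tokens N q (double p) ≡ false
      vacated′ refl = tokens-vacated {N} ≤-refl

  config-cong : ∀ D {σ σ′} → (∀ j → σ j ≡ σ′ j) → SameConfig (config D σ) (config D σ′)
  config-cong D {σ} {σ′} σ≗σ′ = same₁ , same₂
    where
      same₁ : SameSet (side₁ D σ) (side₁ D σ′)
      same₁ (e¹ u) = refl
      same₁ (e² u) = refl
      same₁ (e³ u) = refl
      same₁ (c u k) = refl
      same₁ (s j a) = cong (λ q → track₁ q a) (σ≗σ′ j)
      same₂ : SameSet (side₂ D σ) (side₂ D σ′)
      same₂ (e¹ u) = refl
      same₂ (e² u) = refl
      same₂ (e³ u) = refl
      same₂ (c u k) = refl
      same₂ (s j a) = cong (λ q → track₂ q a) (σ≗σ′ j)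

  resting : Fin m → ℕ
  resting _ = N

  Base : Subset n → Config
  Base D = config D resting

  shiftedTo : Fin m → ℕ → Fin m → ℕ
  shiftedTo j q j′ = if does (j′ ≟ᶠ j) then q else N

  shiftedTo-self : ∀ j q → shiftedTo j q j ≡ q
  shiftedTo-self j q rewrite dec-true (j ≟ᶠ j) refl = refl

  shiftedTo-lowers : ∀ j p → Lowers j p (shiftedTo j (suc p)) (shiftedTo j p)
  shiftedTo-lowers j p = shiftedTo-self j (suc p) , shiftedTo-self j p , elsewhere
    where
      elsewhere : ∀ j′ → ¬ j′ ≡ j → shiftedTo j p j′ ≡ shiftedTo j (suc p) j′
      elsewhere j′ j′≢j rewrite dec-false (j′ ≟ᶠ j) j′≢j = refl

  shift-chain : ∀ D j q → q ≤ N → config D (shiftedTo j q) ⇝⟨ double q ⟩ config D (shiftedTo j 0)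
  shift-chain D j zero _ = ⇝-same sameConfig-refl
  shift-chain D j (suc p) p<N = chain-step D p<N (shiftedTo-lowers j p) ⨾ shift-chain D j p (<⇒≤ p<N)

  unlock : ∀ D j → Base D ⇝⟨ double N ⟩ config D (shiftedTo j 0)
  unlock D j = ⇝-same (config-cong D resting≗shiftedTo) ⨾ shift-chain D j N ≤-refl
    where
      resting≗shiftedTo : ∀ j′ → N ≡ shiftedTo j N j′
      resting≗shiftedTo j′ with does (j′ ≟ᶠ j)
      ... | true = refl
      ... | false = refl

  module SwapSteps (D : Subset n) (σ : Fin m → ℕ) (j : Fin m) (u : Fin n) where

    i : ℕ
    i = idx u j

    P₁ P₂ Q₁ Q₂ Q₁′ Q₂′ Q₁″ Q₂″ Q₂‴ : SetOf Elem
    P₁ = side₁ D σ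
    P₂ = side₂ D σ
    Q₂ = replace P₂ (c u i) (s j 1)
    Q₁ = replace P₁ (e³ u) (c u i)
    Q₂′ = replace Q₂ (e² u) (e³ u)
    Q₁′ = replace Q₁ (e¹ u) (e² u)
    Q₂″ = replace Q₂′ (e³ u) (e¹ u)
    Q₁″ = replace Q₁′ (c u i) (e³ u)
    Q₂‴ = replace Q₂″ (s j 1) (c u i)

    swapped₁ : SameSet Q₁″ (side₁ (D [ u ]≔ true) σ)
    swapped₁ (e¹ v) with v ≟ᶠ u
    ... | yes refl = sym (cong not (lookup∘update u D true))
    ... | no v≢u = cong not (sym (lookup∘update′ v≢u D true))
    swapped₁ (e² v) with v ≟ᶠ u
    ... | yes refl = sym (lookup∘update u D true)
    ... | no v≢u = sym (lookup∘update′ v≢u D true)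
    swapped₁ (e³ v) with v ≟ᶠ u
    ... | yes _ = refl
    ... | no _ = refl
    swapped₁ (c v k) with c v k ≟ᴱ c u i
    ... | yes refl = replace-source Q₁′ (c u i) (e³ u) λ ()
    ... | no ne = trans (replace-other Q₁′ (c u i) (e³ u) ne λ ())
                        (replace-other P₁ (e³ u) (c u i) (λ ()) ne)
    swapped₁ (s _ _) = refl

    swapped₂ : memb j u ≡ true → SameSet Q₂‴ (side₂ (D [ u ]≔ true) σ)
    swapped₂ _ (e¹ v) with v ≟ᶠ u
    ... | yes refl = sym (lookup∘update u D true)
    ... | no v≢u = sym (lookup∘update′ v≢u D true)
    swapped₂ _ (e² v) with v ≟ᶠ u
    ... | yes refl = sym (cong not (lookup∘update u D true))
    ... | no v≢u = cong not (sym (lookup∘update′ v≢u D true))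
    swapped₂ _ (e³ v) with v ≟ᶠ u
    ... | yes _ = refl
    ... | no _ = refl
    swapped₂ u∈j (c v k) with c v k ≟ᴱ c u i
    ... | yes refl = trans (replace-target Q₂″ (s j 1) (c u i)) (sym (cMem-idx u∈j))
    ... | no ne = trans (replace-other Q₂″ (s j 1) (c u i) (λ ()) ne)
                        (replace-other P₂ (c u i) (s j 1) ne λ ())
    swapped₂ _ (s j′ a) with s j′ a ≟ᴱ s j 1
    ... | yes refl = replace-source Q₂″ (s j 1) (c u i) λ ()
    ... | no ne = trans (replace-other Q₂″ (s j 1) (c u i) ne λ ())
                        (replace-other P₂ (c u i) (s j 1) (λ ()) ne)

  -- s_j^1 replaces c_u^{id(u,j)} in B₂, so that c_u^{id(u,j)} can hold the place of e³_u in B₁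
  -- while e³_u moves e²_u into B₁ and e¹_u into B₂.
  swap-element : ∀ D {σ j u} → σ j ≡ 0 → memb j u ≡ true → lookup D u ≡ false →
                 config D σ ⇝⟨ 7 ⟩ config (D [ u ]≔ true) σ
  swap-element D {σ} {j} {u} σj u∈j Du =
    move₂ {x = c u i} {s j 1} (cMem-idx u∈j) refl s₁-free
          (inGround₂ (MS0-block j) (s1∈MS0 j)) (c⇄s u∈j) ⨾
    move₁ {x = e³ u} {c u i} refl refl (replace-source P₂ (c u i) (s j 1) λ ())
          (inGround₁ (Mu3-block u) (there (c∈copies u∈j))) (e³⇄c u∈j) ⨾
    move₂ {x = e² u} {e³ u} (cong not Du) refl (replace-source P₁ (e³ u) (c u i) λ ())
          (inGround₂ (Mu2-block u) (there (there (here refl)))) (e²⇄e³ u) ⨾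
    move₁ {x = e¹ u} {e² u} (cong not Du) Du (replace-source Q₂ (e² u) (e³ u) λ ())
          (inGround₁ (Mu1-block u) (there (here refl))) (e¹⇄e² u) ⨾
    move₂ {x = e³ u} {e¹ u} (replace-target Q₂ (e² u) (e³ u)) Du (replace-source Q₁ (e¹ u) (e² u) λ ())
          (inGround₂ (Mu2-block u) (here refl)) (e³⇄e¹ u) ⨾
    move₁ {x = c u i} {e³ u} (replace-target P₁ (e³ u) (c u i)) (replace-source P₁ (e³ u) (c u i) λ ())
          (replace-source Q₂′ (e³ u) (e¹ u) λ ())
          (inGround₁ (Mu3-block u) (here refl)) (interchangeable-sym M₁ (e³⇄c u∈j)) ⨾
    move₂ {x = s j 1} {c u i} (replace-target P₂ (c u i) (s j 1)) (replace-source P₂ (c u i) (s j 1) λ ())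
          (replace-source Q₁′ (c u i) (e³ u) λ ())
          (inGround₂ (MS0-block j) (c∈MS0 u∈j)) (interchangeable-sym M₂ (c⇄s u∈j)) ⨾
    ⇝-same (swapped₁ , swapped₂ u∈j)
    where
      open SwapSteps D σ j u
      s₁-free : tokens N (σ j) 0 ≡ false
      s₁-free rewrite σj = tokens-vacated {N} {0} {0} z≤n

  base-feasible : ∀ D → Feasible (Base D)
  base-feasible D =
    (ground-B₁ , λ b b∈ → rank₁ (∈M₁⇒M₁-Block b∈)) ,
    (ground-B₂ , λ b b∈ → rank₂ (∈M₂⇒M₂-Block b∈)) ,
    disjoint
    where
      B₁ B₂ : SetOf Elem
      B₁ = side₁ D resting
      B₂ = side₂ D resting

      ground-B₁ : ∀ z → B₁ z ≡ true → InGround M₁ z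
      ground-B₁ (e¹ u) _ = inGround₁ (Mu1-block u) (here refl)
      ground-B₁ (e² u) _ = inGround₁ (Mu1-block u) (there (here refl))
      ground-B₁ (e³ u) _ = inGround₁ (Mu3-block u) (here refl)
      ground-B₁ (s j (suc z)) occupied with tokens-at-rest {N} {z} occupied
      ... | p , p<N , refl = inGround₁ (link₁ j p p<N) (here refl)

      ground-B₂ : ∀ z → B₂ z ≡ true → InGround M₂ z
      ground-B₂ (e¹ u) _ = inGround₂ (Mu2-block u) (here refl)
      ground-B₂ (e² u) _ = inGround₂ (Mu2-block u) (there (here refl))
      ground-B₂ (c u k) claimed with cMem⁻ claimed
      ... | j , u∈j , refl = inGround₂ (MS0-block j) (c∈MS0 u∈j)
      ground-B₂ (s j (suc (suc z))) occupied with tokens-at-rest {N} {z} occupied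
      ... | p , p<N , refl = inGround₂ (link₂ j p p<N) (here refl)

      rank₁ : ∀ {b} → M₁-Block b → count B₁ (proj₁ b) ≡ proj₂ b
      rank₁ (Mu1-block u) with lookup D u in Du
      ... | true rewrite Du = refl
      ... | false rewrite Du = refl
      rank₁ (Mu3-block u) = cong suc (count-map-none B₁ (c u) (oneTo (f u)) λ _ → refl)
      rank₁ (link₁ j p p<N) rewrite tokens-unmoved {N} {N} p<N p<N | tokens-unoccupied {N} {N} p<N = refl

      rank₂ : ∀ {b} → M₂-Block b → count B₂ (proj₁ b) ≡ proj₂ b
      rank₂ (Mu2-block u) with lookup D u in Du
      ... | true rewrite Du = refl
      ... | false rewrite Du = refl
      rank₂ (MS0-block j) =
        trans (count-++ B₂ (copiesIn j) (s j 1 ∷ []))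
              (trans (+-identityʳ _)
                     (count-map-all B₂ (λ v → c v (idx v j)) (members j)
                                    λ v v∈ → cMem-idx (∈-members⁻ v∈)))
      rank₂ (link₂ j p p<N) rewrite tokens-unmoved {N} {N} p<N p<N | tokens-unoccupied {N} {N} p<N = refl

      disjoint : ∀ z → B₁ z ≡ true → B₂ z ≡ false
      disjoint (e¹ u) B₁z with lookup D u
      ... | false = refl
      disjoint (e² u) B₁z rewrite B₁z = refl
      disjoint (e³ u) _ = refl
      disjoint (s j (suc z)) occupied with tokens-at-rest {N} {z} occupied
      ... | zero , _ , refl = refl
      ... | suc p , p<N , refl = tokens-unoccupied {N} (<⇒≤ p<N)

  -- The potential 7 · ∣ marks ∣ pays for the seven exchanges spent on each newly marked element.
  record Progress (P : Subset n → Config) (D : Subset n) (X : Fin n → Set) (budget : ℕ) : Set where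
    field
      marks : Subset n
      grows : ∀ u → lookup D u ≡ true → lookup marks u ≡ true
      covers : ∀ u → X u → lookup marks u ≡ true
      steps : ℕ
      cost : steps + 7 * ∣ D ∣ ≡ budget + 7 * ∣ marks ∣
      path : P D ⇝⟨ steps ⟩ P marks

  stay : ∀ {P D X} → (∀ u → X u → lookup D u ≡ true) → Progress P D X 0
  stay {D = D} X⊆D = record
    { marks = D ; grows = λ _ Du → Du ; covers = X⊆D
    ; steps = 0 ; cost = refl ; path = ⇝-same sameConfig-refl }

  weaken : ∀ {P D X Y b} → (∀ u → Y u → X u ⊎ lookup D u ≡ true) →
           Progress P D X b → Progress P D Y b
  weaken Y⊆X p = record
    { marks = marks ; grows = grows ; covers = λ u Yu → [ covers u , grows u ] (Y⊆X u Yu)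
    ; steps = steps ; cost = cost ; path = path }
    where open Progress p

  infixr 5 _⊕_
  _⊕_ : ∀ {P D X Y} {b b′} (p : Progress P D X b) → Progress P (Progress.marks p) Y b′ →
        Progress P D (λ u → X u ⊎ Y u) (b + b′)
  _⊕_ {b = b} {b′} p q = record
    { marks = Q.marks
    ; grows = λ u Du → Q.grows u (P.grows u Du)
    ; covers = λ u → [ Q.grows u ∘ P.covers u , Q.covers u ]
    ; steps = P.steps + Q.steps
    ; cost = cost-trans P.steps Q.steps b b′ P.cost Q.cost
    ; path = P.path ⨾ Q.path
    }
    where
      module P = Progress p
      module Q = Progress q

  swap-progress : ∀ D {σ j u} → σ j ≡ 0 → memb j u ≡ true → lookup D u ≡ false →
                  Progress (λ D′ → config D′ σ) D (_≡ u) 0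
  swap-progress D {u = u} σj u∈j Du = record
    { marks = D [ u ]≔ true
    ; grows = insert-grows D u
    ; covers = λ { _ refl → lookup∘update u D true }
    ; steps = 7
    ; cost = trans (sym (*-suc 7 ∣ D ∣)) (cong (7 *_) (sym (insert-size D u Du)))
    ; path = swap-element D σj u∈j Du
    }

  Listed : Fin m → List (Fin n) → Fin n → Set
  Listed j us u = u ∈ us × memb j u ≡ true

  skip-head : ∀ {j u us D} → (memb j u ≡ true → lookup D u ≡ true) →
              ∀ v → Listed j (u ∷ us) v → Listed j us v ⊎ lookup D v ≡ true
  skip-head u-done v (here refl , v∈j) = inj₂ (u-done v∈j)
  skip-head u-done v (there v∈ , v∈j) = inj₁ (v∈ , v∈j)

  sweep : ∀ {σ j} → σ j ≡ 0 → ∀ us D → Progress (λ D′ → config D′ σ) D (Listed j us) 0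
  sweep σj [] D = stay λ { _ (() , _) }
  sweep {σ} {j} σj (u ∷ us) D with memb j u in u∈j | lookup D u in Du
  ... | true | false = weaken split (swap-progress D σj u∈j Du ⊕ sweep σj us (D [ u ]≔ true))
    where
      split : ∀ v → Listed j (u ∷ us) v → (v ≡ u ⊎ Listed j us v) ⊎ lookup D v ≡ true
      split v (here refl , _) = inj₁ (inj₁ refl)
      split v (there v∈ , v∈j) = inj₁ (inj₂ (v∈ , v∈j))
  ... | true | true = weaken (skip-head {D = D} λ _ → Du) (sweep σj us D)
  ... | false | _ =
    weaken (skip-head {D = D} λ u∈j′ → contradiction (trans (sym u∈j′) u∈j) λ ()) (sweep σj us D)

  phase-length : ℕ
  phase-length = double N + double N

  phase-length≡2L : phase-length ≡ 2 * L
  phase-length≡2L = cong₂ _+_ (sym (2*≡double N)) (trans (sym (2*≡double N)) (sym (+-identityʳ (2 * N))))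

  phase : ∀ j D → Progress Base D (λ u → memb j u ≡ true) phase-length
  phase j D = record
    { marks = S.marks
    ; grows = S.grows
    ; covers = λ u u∈j → S.covers u (∈-allFin u , u∈j)
    ; steps = double N + (S.steps + double N)
    ; cost = trans (rearrange (double N) S.steps (7 * ∣ D ∣)) (cong (phase-length +_) S.cost)
    ; path = unlock D j ⨾ S.path ⨾ ⇝-reverse (base-feasible S.marks) (unlock S.marks j)
    }
    where
      module S = Progress (sweep {shiftedTo j 0} {j} (shiftedTo-self j 0) (allFin n) D)
      rearrange : ∀ a x y → (a + (x + a)) + y ≡ (a + a) + (x + y)
      rearrange = solve-∀

  Selected : ∀ {k} → Subset k → (Fin k → Fin m) → Fin n → Set
  Selected S ι u = Σ (Fin _) λ i → lookup S i ≡ true × memb (ι i) u ≡ true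

  cover : ∀ {k} (S : Subset k) (ι : Fin k → Fin m) D →
          Progress Base D (Selected S ι) (∣ S ∣ * phase-length)
  cover Vec.[] ι D = stay λ { _ (() , _) }
  cover (true Vec.∷ S) ι D = weaken chosen (phase (ι fzero) D ⊕ cover S (ι ∘ fsuc) _)
    where
      chosen : ∀ u → Selected (true Vec.∷ S) ι u →
               (memb (ι fzero) u ≡ true ⊎ Selected S (ι ∘ fsuc) u) ⊎ lookup D u ≡ true
      chosen u (fzero , _ , u∈) = inj₁ (inj₁ u∈)
      chosen u (fsuc i , i∈S , u∈) = inj₁ (inj₂ (i , i∈S , u∈))
  cover (false Vec.∷ S) ι D = weaken skipped (cover S (ι ∘ fsuc) D)
    where
      skipped : ∀ u → Selected (false Vec.∷ S) ι u → Selected S (ι ∘ fsuc) u ⊎ lookup D u ≡ true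
      skipped u (fsuc i , i∈S , u∈) = inj₁ (i , i∈S , u∈)

  Occupies : (ℕ → Bool) → (ℕ → ℕ) → Set
  Occupies h pos = (∀ {k} → h k ≡ true → Σ ℕ λ p → p < N × pos p ≡ k) ×
                   (∀ {p} → p < N → h (pos p) ≡ true)

  same-occupancy : ∀ {h h′ pos} → Occupies h pos → Occupies h′ pos → ∀ k → h k ≡ h′ k
  same-occupancy {h} {h′} h-at h′-at k = true⇔true⇒≡ (transfer h-at h′-at) (transfer h′-at h-at)
    where
      transfer : ∀ {g g′ pos} → Occupies g pos → Occupies g′ pos → g k ≡ true → g′ k ≡ true
      transfer (g⁻ , _) (_ , g′⁺) gk with p , p<N , refl ← g⁻ gk = g′⁺ p<N

  oneTo-occupies : ∀ (g : ℕ → ℕ) → Occupies (λ k → any (λ i → g i ≡ᵇ k) (oneTo N)) (g ∘ suc)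
  oneTo-occupies g = occupied⁻ , occupied⁺
    where
      occupied⁻ : ∀ {k} → any (λ i → g i ≡ᵇ k) (oneTo N) ≡ true →
                  Σ ℕ λ p → p < N × g (suc p) ≡ k
      occupied⁻ hit with i , i∈ , gi≡k ← find (any⁻ _ (oneTo N) (Equivalence.from T-≡ hit))
                    with p , p∈ , refl ← ∈-map⁻ suc i∈
        = p , ∈-upTo⁻ p∈ , ≡ᵇ⇒≡ _ _ gi≡k
      occupied⁺ : ∀ {p} → p < N → any (λ i → g i ≡ᵇ g (suc p)) (oneTo N) ≡ true
      occupied⁺ {p} p<N =
        Equivalence.to T-≡ (any⁺ _ (lose (∈-map⁺ suc (∈-upTo⁺ p<N)) (≡⇒≡ᵇ (g (suc p)) _ refl)))

  occupies-cong : ∀ {h pos pos′} → (∀ p → pos p ≡ pos′ p) → Occupies h pos → Occupies h pos′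
  occupies-cong {h} pos≗pos′ (h⁻ , h⁺) =
    (λ hk → let (p , p<N , at) = h⁻ hk in p , p<N , trans (sym (pos≗pos′ p)) at) ,
    (λ {p} p<N → subst (λ k → h k ≡ true) (pos≗pos′ p) (h⁺ p<N))

  track₁-occupies : Occupies (track₁ N) (suc ∘ double)
  track₁-occupies = occupied⁻ , λ p<N → tokens-unmoved {N} p<N p<N
    where
      occupied⁻ : ∀ {k} → track₁ N k ≡ true → Σ ℕ λ p → p < N × suc (double p) ≡ k
      occupied⁻ {suc z} hit with p , p<N , refl ← tokens-at-rest {N} {z} hit = p , p<N , refl

  track₂-occupies : Occupies (track₂ N) (double ∘ suc)
  track₂-occupies = occupied⁻ , λ p<N → tokens-unmoved {N} p<N p<N
    where
      occupied⁻ : ∀ {k} → track₂ N k ≡ true → Σ ℕ λ p → p < N × double (suc p) ≡ k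
      occupied⁻ {suc (suc z)} hit with p , p<N , refl ← tokens-at-rest {N} {z} hit = p , p<N , refl

  oddS≗track₁ : ∀ k → oddS k ≡ track₁ N k
  oddS≗track₁ =
    same-occupancy (occupies-cong (cong (_∸ 1) ∘ 2*≡double ∘ suc) (oneTo-occupies λ i → 2 * i ∸ 1))
                   track₁-occupies

  evenS≗track₂ : ∀ k → evenS k ≡ track₂ N k
  evenS≗track₂ =
    same-occupancy (occupies-cong (2*≡double ∘ suc) (oneTo-occupies λ i → 2 * i)) track₂-occupies

  start : SameConfig 𝔹s (Base ⊥)
  start = same₁ , same₂
    where
      same₁ : SameSet Bs₁ (side₁ ⊥ resting)
      same₁ (e¹ u) = sym (cong not (lookup-replicate u false))
      same₁ (e² u) = sym (lookup-replicate u false)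
      same₁ (e³ u) = refl
      same₁ (c u k) = refl
      same₁ (s j k) = oddS≗track₁ k
      same₂ : SameSet Bs₂ (side₂ ⊥ resting)
      same₂ (e¹ u) = sym (lookup-replicate u false)
      same₂ (e² u) = sym (cong not (lookup-replicate u false))
      same₂ (e³ u) = refl
      same₂ (c u k) = refl
      same₂ (s j k) = evenS≗track₂ k

  finish : ∀ D → (∀ u → lookup D u ≡ true) → SameConfig (Base D) 𝔹t
  finish D full = same₁ , same₂
    where
      same₁ : SameSet (side₁ D resting) Bt₁
      same₁ (e¹ u) = cong not (full u)
      same₁ (e² u) = full u
      same₁ (e³ u) = refl
      same₁ (c u k) = refl
      same₁ (s j k) = sym (oddS≗track₁ k)
      same₂ : SameSet (side₂ D resting) Bt₂
      same₂ (e¹ u) = full u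
      same₂ (e² u) = cong not (full u)
      same₂ (e³ u) = refl
      same₂ (c u k) = refl
      same₂ (s j k) = sym (evenS≗track₂ k)

  reconfiguration : ∀ (S* : Subset m) → (∀ u → Selected S* id u) →
                    Σ ℕ λ ℓ → ℓ ≤ ∣ S* ∣ * phase-length + 7 * n × Reconf ℓ 𝔹s 𝔹t
  reconfiguration S* covered = C.steps + 0 , bound , sequence
    where
      module C = Progress (cover S* id ⊥)
      sequence : Reconf (C.steps + 0) 𝔹s 𝔹t
      sequence = (⇝-same start ⨾ C.path ⨾ ⇝-same (finish C.marks λ u → C.covers u (covered u)))
                   (feasible-cong (sameConfig-sym start) (base-feasible ⊥))
      bound : C.steps + 0 ≤ ∣ S* ∣ * phase-length + 7 * n
      bound = begin
        C.steps + 0                              ≡⟨ cong (λ d → C.steps + 7 * d) (∣⊥∣≡0 n) ⟨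
        C.steps + 7 * ∣ ⊥ {n = n} ∣               ≡⟨ C.cost ⟩
        ∣ S* ∣ * phase-length + 7 * ∣ C.marks ∣   ≤⟨ +-monoʳ-≤ (∣ S* ∣ * phase-length)
                                                             (*-monoʳ-≤ 7 (∣p∣≤n C.marks)) ⟩
        ∣ S* ∣ * phase-length + 7 * n            ∎
        where open ≤-Reasoning

lemma4 : (n m : ℕ) (𝒮 : Fin m → Subset n) → Injective _≡_ _≡_ 𝒮 →
    (∀ (u : Fin n) → ∃ λ (j : Fin m) → lookup (𝒮 j) u ≡ true) →
    (k : ℕ) (S* : Subset m) → ∣ S* ∣ ≤ k →
    (∀ (u : Fin n) → ∃ λ (j : Fin m) → (lookup S* j ≡ true) × (lookup (𝒮 j) u ≡ true)) →
    Σ ℕ λ ℓ → (ℓ ≤ 2 * k * Construction.L n m 𝒮 + 7 * n) ×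
      Construction.Reconf n m 𝒮 ℓ (Construction.𝔹s n m 𝒮) (Construction.𝔹t n m 𝒮)
lemma4 n m 𝒮 _ _ k S* ∣S*∣≤k covered
  with ℓ , ℓ≤ , sequence ← Sequence.reconfiguration n m 𝒮 S* covered =
  ℓ , ≤-trans ℓ≤ (+-monoˡ-≤ (7 * n) phases≤) , sequence
  where
    open Sequence n m 𝒮 using (phase-length; phase-length≡2L)
    open Construction n m 𝒮 using (L)
    phases≤ : ∣ S* ∣ * phase-length ≤ 2 * k * L
    phases≤ = begin
      ∣ S* ∣ * phase-length  ≤⟨ *-monoˡ-≤ phase-length ∣S*∣≤k ⟩
      k * phase-length       ≡⟨ cong (k *_) phase-length≡2L ⟩
      k * (2 * L)            ≡⟨ regroup k L ⟩
      2 * k * L              ∎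
      where
        open ≤-Reasoning
        regroup : ∀ k L → k * (2 * L) ≡ 2 * k * L
        regroup = solve-∀
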